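{- Let $G$ be a finite graph with average degree $\overline{d}\geq 4$. Then $$F(G)^{1/v(G)}\leq \exp\left(\frac{\overline{d}}{2}H\left(\frac{2}{\overline{d}}\right)\right).$$
   Context: $v(G)$ is the number of vertices of $G$; $F(G)$ is the number of forests of $G$, i.e. edge subsets $A\subseteq E(G)$ containing no cycle. $H(x)=x\ln(1/x)+(1-x)\ln(1/(1-x))$ is the entropy function (natural logarithm), with $H(0)=H(1)=0$. -}

module Defs where

open import Data.Nat using (ℕ; zero; suc)
open import Data.Nat.DivMod using (_mod_)
open import Data.Fin using (Fin; toℕ)
open import Data.Fin.Subset using (Subset; _∈_)
open import Data.Product using (_×_; _,_; Σ; ∃)
open import Data.Sum using (_⊎_)
open import Data.Empty using (⊥)
open import Relation.Binary.PropositionalEquality using (_≡_)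
open import Function.Definitions using (Injective)
open import Relation.Nullary using (¬_)

-- Each edge e has an (unordered) pair of endpoints, recorded as ends e;
-- loops (both endpoints equal) and parallel edges are allowed.
Graph : ℕ → ℕ → Set
Graph n m = Fin m → Fin n × Fin n

Joins : ∀ {n m} → Graph n m → Fin m → Fin n → Fin n → Set
Joins G e u v = (G e ≡ (u , v)) ⊎ (G e ≡ (v , u))

next : ∀ {k} → Fin (suc k) → Fin (suc k)
next {k} i = suc (toℕ i) mod (suc k)

-- A cycle of length (suc k) inside the edge set A:
-- distinct edges f 0 … f k, all in A, distinct vertices g 0 … g k,
-- edge f i joining g i and g (i+1 mod (k+1)).
-- (length 1 = loop, length 2 = pair of parallel edges)
record CycleIn {n m : ℕ} (G : Graph n m) (A : Subset m) : Set where
  field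
    k      : ℕ
    edge   : Fin (suc k) → Fin m
    vertex : Fin (suc k) → Fin n
    edge-inj   : Injective _≡_ _≡_ edge
    vertex-inj : Injective _≡_ _≡_ vertex
    edge-in    : ∀ i → edge i ∈ A
    joins      : ∀ i → Joins G (edge i) (vertex i) (vertex (next i))

IsForest : ∀ {n m} → Graph n m → Subset m → Set
IsForest G A = ¬ CycleIn G A

{-# OPTIONS --safe #-}
-- A forest on n vertices has at most n edges: adding its edges one by one, each
-- joins two different components (otherwise a walk between its ends would close
-- a cycle), so the number of components drops. Now weight an edge set A by
-- n ^ ∣A∣ * (m ∸ n) ^ (m ∸ ∣A∣). Since n ≤ m ∸ n, every forest has weight at least
-- n ^ n * (m ∸ n) ^ (m ∸ n), while by the binomial theorem the weights of all edge
-- sets sum to (n + (m ∸ n)) ^ m = m ^ m.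
module Submission where

open import Defs
open import Algebra.Properties.CommutativeSemigroup using (x∙yz≈y∙xz)
import Data.Bool.Properties as Bool
open import Data.Empty using (⊥-elim)
open import Data.Fin using (Fin; zero; suc; toℕ; fromℕ; inject₁)
open import Data.Fin.Properties
  using (suc-injective; toℕ-injective; toℕ-fromℕ<; toℕ-fromℕ; toℕ-inject₁; toℕ<n; any?)
  renaming (_≟_ to _≟ᶠ_)
open import Data.Fin.Relation.Unary.Top using (view; ‵fromℕ; ‵inject₁)
open import Data.Fin.Subset using (Subset; Side; _∈_; _-_; ∁; ∣_∣; inside; outside) renaming (⊤ to full)
open import Data.Fin.Subset.Properties using (∈⊤; ∣⊤∣≡n; ∣∁p∣≡n∸∣p∣; x∈p∧x≢y⇒x∈p-y; x∈p⇒∣p-x∣<∣p∣)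
open import Data.List using (List; []; _∷_; length; map)
open import Data.List.Membership.Propositional using () renaming (_∈_ to _∈ₗ_)
open import Data.List.Properties using (length-map)
open import Data.List.Relation.Unary.All using (All; []; _∷_; lookup)
import Data.List.Relation.Unary.All as All
import Data.List.Relation.Unary.All.Properties as All
open import Data.List.Relation.Unary.AllPairs using ([]; _∷_)
open import Data.List.Relation.Unary.Any using (here; there)
open import Data.List.Relation.Unary.Unique.Propositional using (Unique)
import Data.List.Relation.Unary.Unique.Propositional.Properties as Unique
open import Data.Nat using (ℕ; zero; suc; _+_; _*_; _∸_; _^_; _≤_; z≤n; s≤s)
open import Data.Nat.DivMod using (_%_; n%n≡0; m<n⇒m%n≡m)
open import Data.Nat.ListAction using (sum)
open import Data.Nat.Properties
  using ( ≤-refl; ≤-reflexive; ≤-trans; module ≤-Reasoning; m≤m+n; m≤n+m; m+n≤o⇒m≤o∸n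
        ; +-comm; +-assoc; +-suc; +-identityʳ; +-mono-≤; +-monoˡ-≤; +-commutativeSemigroup
        ; *-assoc; *-zeroʳ; *-distribˡ-+; *-distribʳ-+; *-monoˡ-≤; *-monoʳ-≤; *-cancelˡ-≤; *-commutativeSemigroup
        ; m+[n∸m]≡n; m∸n+n≡m; +-∸-assoc; ^-distribˡ-+-*; ^-monoˡ-≤ )
open import Data.Nat.Tactic.RingSolver using (solve-∀)
open import Data.Product using (_×_; _,_; Σ; proj₁; proj₂)
open import Data.Sum using (_⊎_; inj₁; inj₂; [_,_]′)
open import Data.Unit using (⊤)
open import Data.Vec.Base using (_∷_; [])
import Data.Vec.Base as Vec
open import Function using (_∘_)
open import Function.Definitions using (Injective)
open import Relation.Binary.PropositionalEquality
open import Relation.Nullary using (¬_; yes; no)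

next-fromℕ : ∀ k → next (fromℕ k) ≡ zero
next-fromℕ k = toℕ-injective (begin
  toℕ (next (fromℕ k))     ≡⟨ toℕ-fromℕ< _ ⟩
  suc (toℕ (fromℕ k)) % suc k ≡⟨ cong (λ i → suc i % suc k) (toℕ-fromℕ k) ⟩
  suc k % suc k            ≡⟨ n%n≡0 (suc k) ⟩
  0                        ∎)
  where open ≡-Reasoning

next-inject₁ : ∀ {k} (i : Fin k) → next (inject₁ i) ≡ suc i
next-inject₁ {k} i = toℕ-injective (begin
  toℕ (next (inject₁ i))       ≡⟨ toℕ-fromℕ< _ ⟩
  suc (toℕ (inject₁ i)) % suc k ≡⟨ cong (λ j → suc j % suc k) (toℕ-inject₁ i) ⟩
  suc (toℕ i) % suc k           ≡⟨ m<n⇒m%n≡m (s≤s (toℕ<n i)) ⟩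
  suc (toℕ i)                   ∎)
  where open ≡-Reasoning

module _ {n m : ℕ} (G : Graph n m) where

  Joins-sym : ∀ {e x y} → Joins G e x y → Joins G e y x
  Joins-sym (inj₁ p) = inj₂ p
  Joins-sym (inj₂ p) = inj₁ p

  Endpoint : Fin m → Fin n → Set
  Endpoint e x = proj₁ (G e) ≡ x ⊎ proj₂ (G e) ≡ x

  Joins⇒Endpoint : ∀ {e x y} → Joins G e x y → Endpoint e x
  Joins⇒Endpoint (inj₁ refl) = inj₁ refl
  Joins⇒Endpoint (inj₂ refl) = inj₂ refl

  Joins∧Endpoint⇒≡ : ∀ {e x y z} → Joins G e x y → Endpoint e z → x ≡ z ⊎ y ≡ z
  Joins∧Endpoint⇒≡ (inj₁ refl) p = p
  Joins∧Endpoint⇒≡ (inj₂ refl) (inj₁ q) = inj₂ q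
  Joins∧Endpoint⇒≡ (inj₂ refl) (inj₂ q) = inj₁ q

  data Walk (P : Fin m → Set) : Fin n → Fin n → Set where
    [] : ∀ {x} → Walk P x x
    step : ∀ {x y z} e → P e → Joins G e x y → Walk P y z → Walk P x z

  mapWalk : ∀ {P Q : Fin m → Set} → (∀ {e} → P e → Q e) → ∀ {x y} → Walk P x y → Walk Q x y
  mapWalk f [] = []
  mapWalk f (step e p j w) = step e (f p) j (mapWalk f w)

  module _ {P : Fin m → Set} where

    _++_ : ∀ {x y z} → Walk P x y → Walk P y z → Walk P x z
    [] ++ w′ = w′
    step e p j w ++ w′ = step e p j (w ++ w′)

    reverse : ∀ {x y} → Walk P x y → Walk P y x
    reverse [] = []
    reverse (step e p j w) = reverse w ++ step e p (Joins-sym j) []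

    len : ∀ {x y} → Walk P x y → ℕ
    len [] = 0
    len (step e p j w) = suc (len w)

    vertex : ∀ {x y} (w : Walk P x y) → Fin (suc (len w)) → Fin n
    vertex {x} [] zero = x
    vertex {x} (step e p j w) zero = x
    vertex (step e p j w) (suc i) = vertex w i

    vertex-zero : ∀ {x y} (w : Walk P x y) → vertex w zero ≡ x
    vertex-zero [] = refl
    vertex-zero (step e p j w) = refl

    vertex-last : ∀ {x y} (w : Walk P x y) → vertex w (fromℕ (len w)) ≡ y
    vertex-last [] = refl
    vertex-last (step e p j w) = vertex-last w

    Simple : ∀ {x y} → Walk P x y → Set
    Simple [] = ⊤
    Simple {x} (step e p j w) = (∀ i → vertex w i ≢ x) × Simple w

    vertex-injective : ∀ {x y} (w : Walk P x y) → Simple w → Injective _≡_ _≡_ (vertex w)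
    vertex-injective [] _ {zero} {zero} _ = refl
    vertex-injective (step e p j w) _ {zero} {zero} _ = refl
    vertex-injective (step e p j w) (x∉w , _) {zero} {suc i} eq = ⊥-elim (x∉w i (sym eq))
    vertex-injective (step e p j w) (x∉w , _) {suc i} {zero} eq = ⊥-elim (x∉w i eq)
    vertex-injective (step e p j w) (_ , s) {suc i} {suc i′} eq = cong suc (vertex-injective w s eq)

    suffix : ∀ {x y z} (w : Walk P y z) → Simple w → ∀ i → vertex w i ≡ x → Σ (Walk P x z) Simple
    suffix [] s zero refl = [] , s
    suffix (step e p j w) s zero refl = step e p j w , s
    suffix (step e p j w) (_ , s) (suc i) eq = suffix w s i eq

    erase-loops : ∀ {x y} → Walk P x y → Σ (Walk P x y) Simple
    erase-loops [] = [] , _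
    erase-loops {x} (step e p j w) with erase-loops w
    ... | w′ , s with any? (λ i → vertex w′ i ≟ᶠ x)
    ...   | yes (i , eq) = suffix w′ s i eq
    ...   | no x∉w′ = step e p j w′ , (λ i eq → x∉w′ (i , eq)) , s

    cycleEdge : ∀ {x y} (w : Walk P x y) → Fin m → Fin (suc (len w)) → Fin m
    cycleEdge [] e zero = e
    cycleEdge (step f p j w) e zero = f
    cycleEdge (step f p j w) e (suc i) = cycleEdge w e i

    cycleEdge-last : ∀ {x y} (w : Walk P x y) e → cycleEdge w e (fromℕ (len w)) ≡ e
    cycleEdge-last [] e = refl
    cycleEdge-last (step f p j w) e = cycleEdge-last w e

    cycleEdge-joins : ∀ {x y} (w : Walk P x y) e (i : Fin (len w)) →
      Joins G (cycleEdge w e (inject₁ i)) (vertex w (inject₁ i)) (vertex w (suc i))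
    cycleEdge-joins (step f p j w) e zero = subst (Joins G f _) (sym (vertex-zero w)) j
    cycleEdge-joins (step f p j w) e (suc i) = cycleEdge-joins w e i

    cycleEdge-∈ : ∀ {x y} (w : Walk P x y) e i → cycleEdge w e i ≡ e ⊎ P (cycleEdge w e i)
    cycleEdge-∈ [] e zero = inj₁ refl
    cycleEdge-∈ (step f p j w) e zero = inj₂ p
    cycleEdge-∈ (step f p j w) e (suc i) = cycleEdge-∈ w e i

    -- Each cycle edge is the closing edge e ∉ P or joins two vertices of w,
    -- so it is never an edge of P at a vertex off w.
    cycleEdge-avoids : ∀ {x y z f e} (w : Walk P y z) → (∀ i → vertex w i ≢ x) → P f → ¬ P e →
      Endpoint f x → ∀ i → cycleEdge w e i ≢ f
    cycleEdge-avoids [] x∉w pf ¬pe _ zero refl = ¬pe pf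
    cycleEdge-avoids (step g pg j w) x∉w pf ¬pe fx zero refl with Joins∧Endpoint⇒≡ j fx
    ... | inj₁ q = x∉w zero q
    ... | inj₂ q = x∉w (suc zero) (trans (vertex-zero w) q)
    cycleEdge-avoids (step g pg j w) x∉w pf ¬pe fx (suc i) = cycleEdge-avoids w (x∉w ∘ suc) pf ¬pe fx i

    cycleEdge-injective : ∀ {x y e} (w : Walk P x y) → Simple w → ¬ P e → Injective _≡_ _≡_ (cycleEdge w e)
    cycleEdge-injective [] _ _ {zero} {zero} _ = refl
    cycleEdge-injective (step f p j w) _ _ {zero} {zero} _ = refl
    cycleEdge-injective (step f p j w) (x∉w , _) ¬pe {zero} {suc i} eq =
      ⊥-elim (cycleEdge-avoids w x∉w p ¬pe (Joins⇒Endpoint j) i (sym eq))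
    cycleEdge-injective (step f p j w) (x∉w , _) ¬pe {suc i} {zero} eq =
      ⊥-elim (cycleEdge-avoids w x∉w p ¬pe (Joins⇒Endpoint j) i eq)
    cycleEdge-injective (step f p j w) (_ , s) ¬pe {suc i} {suc i′} eq = cong suc (cycleEdge-injective w s ¬pe eq)

    cycleEdge-joins-next : ∀ {x y e} (w : Walk P x y) → Joins G e y x →
      ∀ i → Joins G (cycleEdge w e i) (vertex w i) (vertex w (next i))
    cycleEdge-joins-next {e = e} w e-yx i with view i
    ... | ‵fromℕ rewrite cycleEdge-last w e | vertex-last w | next-fromℕ (len w) | vertex-zero w = e-yx
    ... | ‵inject₁ j rewrite next-inject₁ j = cycleEdge-joins w e j

    closeCycle : ∀ {A x y e} (w : Walk P x y) → Simple w → (∀ {f} → P f → f ∈ A) → e ∈ A → ¬ P e →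
      Joins G e y x → CycleIn G A
    closeCycle {A} {e = e} w s P⊆A e∈A ¬pe e-yx = record
      { k          = len w
      ; edge       = cycleEdge w e
      ; vertex     = vertex w
      ; edge-inj   = cycleEdge-injective w s ¬pe
      ; vertex-inj = vertex-injective w s
      ; edge-in    = λ i → [ (λ eq → subst (_∈ A) (sym eq) e∈A) , P⊆A ]′ (cycleEdge-∈ w e i)
      ; joins      = cycleEdge-joins-next w e-yx
      }

    walk+edge⇒cycle : ∀ {A x y e} → Walk P x y → (∀ {f} → P f → f ∈ A) → e ∈ A → ¬ P e →
      Joins G e y x → CycleIn G A
    walk+edge⇒cycle w = closeCycle (proj₁ (erase-loops w)) (proj₂ (erase-loops w))

  record Rooting (es : List (Fin m)) : Set where
    field
      root          : Fin n → Fin n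
      roots         : Subset n
      root∈roots    : ∀ x → root x ∈ roots
      root-walk     : ∀ x → Walk (_∈ₗ es) x (root x)
      roots+edges≤n : ∣ roots ∣ + length es ≤ n

  discrete : Rooting []
  discrete = record
    { root          = λ x → x
    ; roots         = full
    ; root∈roots    = λ _ → ∈⊤
    ; root-walk     = λ _ → []
    ; roots+edges≤n = ≤-reflexive (trans (+-identityʳ _) (∣⊤∣≡n n))
    }

  module _ {es : List (Fin m)} (ρ : Rooting es) (e : Fin m) where
    open Rooting ρ

    private
      u v : Fin n
      u = proj₁ (G e)
      v = proj₂ (G e)

    merge : root u ≢ root v → Rooting (e ∷ es)
    merge ru≢rv = record
      { root          = root′
      ; roots         = roots - root v
      ; root∈roots    = root′∈roots
      ; root-walk     = root′-walk
      ; roots+edges≤n = roots′+edges≤n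
      }
      where
      old : ∀ {x y} → Walk (_∈ₗ es) x y → Walk (_∈ₗ e ∷ es) x y
      old = mapWalk there

      root′ : Fin n → Fin n
      root′ x with root x ≟ᶠ root v
      ... | yes _ = root u
      ... | no _  = root x

      root′∈roots : ∀ x → root′ x ∈ roots - root v
      root′∈roots x with root x ≟ᶠ root v
      ... | yes _     = x∈p∧x≢y⇒x∈p-y (root∈roots u) ru≢rv
      ... | no rx≢rv  = x∈p∧x≢y⇒x∈p-y (root∈roots x) rx≢rv

      root′-walk : ∀ x → Walk (_∈ₗ e ∷ es) x (root′ x)
      root′-walk x with root x ≟ᶠ root v
      ... | yes rx≡rv = old (subst (Walk _ x) rx≡rv (root-walk x))
                        ++ (old (reverse (root-walk v)) ++ step e (here refl) (inj₂ refl) (old (root-walk u)))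
      ... | no _      = old (root-walk x)

      roots′+edges≤n : ∣ roots - root v ∣ + suc (length es) ≤ n
      roots′+edges≤n = begin
        ∣ roots - root v ∣ + suc (length es)  ≡⟨ +-suc _ _ ⟩
        suc ∣ roots - root v ∣ + length es    ≤⟨ +-monoˡ-≤ _ (x∈p⇒∣p-x∣<∣p∣ (root∈roots v)) ⟩
        ∣ roots ∣ + length es                ≤⟨ roots+edges≤n ⟩
        n                                    ∎
        where open ≤-Reasoning

    same-root⇒cycle : ∀ {A} → All (_∈ A) es → e ∈ A → ¬ e ∈ₗ es → root u ≡ root v → CycleIn G A
    same-root⇒cycle es⊆A e∈A e∉es ru≡rv =
      walk+edge⇒cycle (root-walk u ++ subst (λ r → Walk _ r v) (sym ru≡rv) (reverse (root-walk v)))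
                      (lookup es⊆A) e∈A e∉es (inj₂ refl)

  rooting : ∀ {A es} → IsForest G A → Unique es → All (_∈ A) es → Rooting es
  rooting forest [] [] = discrete
  rooting {es = e ∷ es} forest uniq@(_ ∷ uniq′) (e∈A ∷ es⊆A) with rooting forest uniq′ es⊆A
  ... | ρ with Rooting.root ρ (proj₁ (G e)) ≟ᶠ Rooting.root ρ (proj₂ (G e))
  ...   | yes ru≡rv =
    ⊥-elim (forest (same-root⇒cycle ρ e es⊆A e∈A (Unique.Unique[x∷xs]⇒x∉xs uniq) ru≡rv))
  ...   | no ru≢rv  = merge ρ e ru≢rv

  forest-edges≤n : ∀ {A es} → IsForest G A → Unique es → All (_∈ A) es → length es ≤ n
  forest-edges≤n forest uniq es⊆A = ≤-trans (m≤n+m _ _) (Rooting.roots+edges≤n (rooting forest uniq es⊆A))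

members : ∀ {d} → Subset d → List (Fin d)
members []            = []
members (inside ∷ p)  = zero ∷ map suc (members p)
members (outside ∷ p) = map suc (members p)

members-unique : ∀ {d} (p : Subset d) → Unique (members p)
members-unique []            = []
members-unique (inside ∷ p)  =
  All.map⁺ (All.universal (λ _ ()) (members p)) ∷ Unique.map⁺ suc-injective (members-unique p)
members-unique (outside ∷ p) = Unique.map⁺ suc-injective (members-unique p)

members-∈ : ∀ {d} (p : Subset d) → All (_∈ p) (members p)
members-∈ []            = []
members-∈ (inside ∷ p)  = Vec.here ∷ All.map⁺ (All.map Vec.there (members-∈ p))
members-∈ (outside ∷ p) = All.map⁺ (All.map Vec.there (members-∈ p))

length-members : ∀ {d} (p : Subset d) → length (members p) ≡ ∣ p ∣
length-members []            = refl
length-members (inside ∷ p)  = cong suc (trans (length-map suc (members p)) (length-members p))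
length-members (outside ∷ p) = trans (length-map suc (members p)) (length-members p)

∣forest∣≤n : ∀ {n m} (G : Graph n m) {A} → IsForest G A → ∣ A ∣ ≤ n
∣forest∣≤n {n} G {A} forest =
  subst (_≤ n) (length-members A) (forest-edges≤n G forest (members-unique A) (members-∈ A))

tailsWith : ∀ {d} → Side → List (Subset (suc d)) → List (Subset d)
tailsWith s [] = []
tailsWith s ((x ∷ p) ∷ L) with x Bool.≟ s
... | yes _ = p ∷ tailsWith s L
... | no _  = tailsWith s L

tailsWith-∌ : ∀ {d s} {p : Subset d} (L : List (Subset (suc d))) →
  All (s ∷ p ≢_) L → All (p ≢_) (tailsWith s L)
tailsWith-∌ [] [] = []
tailsWith-∌ {s = s} ((x ∷ q) ∷ L) (sp≢xq ∷ sp∉L) with x Bool.≟ s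
... | yes refl = (sp≢xq ∘ cong (s ∷_)) ∷ tailsWith-∌ L sp∉L
... | no _     = tailsWith-∌ L sp∉L

tailsWith-unique : ∀ {d} s (L : List (Subset (suc d))) → Unique L → Unique (tailsWith s L)
tailsWith-unique s [] [] = []
tailsWith-unique s ((x ∷ p) ∷ L) (xp∉L ∷ uniq) with x Bool.≟ s
... | yes refl = tailsWith-∌ L xp∉L ∷ tailsWith-unique s L uniq
... | no _     = tailsWith-unique s L uniq

length*≤sum : ∀ {A : Set} {c} (f : A → ℕ) (xs : List A) →
  All (λ x → c ≤ f x) xs → length xs * c ≤ sum (map f xs)
length*≤sum f [] [] = z≤n
length*≤sum f (x ∷ xs) (c≤fx ∷ c≤fxs) = +-mono-≤ c≤fx (length*≤sum f xs c≤fxs)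

a^k*b^[d∸k]-antitone : ∀ {a b i k d} → a ≤ b → i ≤ k → k ≤ d →
  a ^ k * b ^ (d ∸ k) ≤ a ^ i * b ^ (d ∸ i)
a^k*b^[d∸k]-antitone {a} {b} {i} {k} {d} a≤b i≤k k≤d = begin
  a ^ k * b ^ (d ∸ k)          ≡⟨ cong (λ j → a ^ j * b ^ (d ∸ k)) (sym (m+[n∸m]≡n i≤k)) ⟩
  a ^ (i + t) * b ^ (d ∸ k)    ≡⟨ cong (_* b ^ (d ∸ k)) (^-distribˡ-+-* a i t) ⟩
  a ^ i * a ^ t * b ^ (d ∸ k)  ≡⟨ *-assoc (a ^ i) _ _ ⟩
  a ^ i * (a ^ t * b ^ (d ∸ k)) ≤⟨ *-monoʳ-≤ (a ^ i) (*-monoˡ-≤ (b ^ (d ∸ k)) (^-monoˡ-≤ t a≤b)) ⟩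
  a ^ i * (b ^ t * b ^ (d ∸ k)) ≡⟨ cong (a ^ i *_) (sym (^-distribˡ-+-* b t (d ∸ k))) ⟩
  a ^ i * b ^ (t + (d ∸ k))    ≡⟨ cong (λ j → a ^ i * b ^ j) t+[d∸k]≡d∸i ⟩
  a ^ i * b ^ (d ∸ i)          ∎
  where
  open ≤-Reasoning
  t = k ∸ i
  t+[d∸k]≡d∸i : t + (d ∸ k) ≡ d ∸ i
  t+[d∸k]≡d∸i = begin-equality
    t + (d ∸ k)        ≡⟨ +-comm t _ ⟩
    d ∸ k + (k ∸ i)    ≡⟨ sym (+-∸-assoc (d ∸ k) i≤k) ⟩
    d ∸ k + k ∸ i      ≡⟨ cong (_∸ i) (m∸n+n≡m k≤d) ⟩
    d ∸ i              ∎

module _ (a b : ℕ) where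

  weight : ∀ {d} → Subset d → ℕ
  weight []            = 1
  weight (inside ∷ p)  = a * weight p
  weight (outside ∷ p) = b * weight p

  weight≡ : ∀ {d} (p : Subset d) → weight p ≡ a ^ ∣ p ∣ * b ^ ∣ ∁ p ∣
  weight≡ []            = refl
  weight≡ (inside ∷ p)  = trans (cong (a *_) (weight≡ p)) (sym (*-assoc a _ _))
  weight≡ (outside ∷ p) =
    trans (cong (b *_) (weight≡ p)) (x∙yz≈y∙xz *-commutativeSemigroup b (a ^ ∣ p ∣) (b ^ ∣ ∁ p ∣))

  Σweight : ∀ {d} → List (Subset d) → ℕ
  Σweight L = sum (map weight L)

  Σweight-split : ∀ {d} (L : List (Subset (suc d))) →
    Σweight L ≡ a * Σweight (tailsWith inside L) + b * Σweight (tailsWith outside L)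
  Σweight-split [] = sym (cong₂ _+_ (*-zeroʳ a) (*-zeroʳ b))
  Σweight-split ((inside ∷ p) ∷ L) = begin
    a * weight p + Σweight L                        ≡⟨ cong (a * weight p +_) (Σweight-split L) ⟩
    a * weight p + (a * Σweight L₁ + b * Σweight L₀) ≡⟨ sym (+-assoc (a * weight p) _ _) ⟩
    a * weight p + a * Σweight L₁ + b * Σweight L₀   ≡⟨ cong (_+ b * Σweight L₀) (sym (*-distribˡ-+ a _ _)) ⟩
    a * (weight p + Σweight L₁) + b * Σweight L₀     ∎
    where
    open ≡-Reasoning
    L₁ = tailsWith inside L
    L₀ = tailsWith outside L
  Σweight-split ((outside ∷ p) ∷ L) = begin
    b * weight p + Σweight L                        ≡⟨ cong (b * weight p +_) (Σweight-split L) ⟩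
    b * weight p + (a * Σweight L₁ + b * Σweight L₀)
      ≡⟨ x∙yz≈y∙xz +-commutativeSemigroup (b * weight p) (a * Σweight L₁) _ ⟩
    a * Σweight L₁ + (b * weight p + b * Σweight L₀) ≡⟨ cong (a * Σweight L₁ +_) (sym (*-distribˡ-+ b _ _)) ⟩
    a * Σweight L₁ + b * (weight p + Σweight L₀)     ∎
    where
    open ≡-Reasoning
    L₁ = tailsWith inside L
    L₀ = tailsWith outside L

  Σweight≤ : ∀ d (L : List (Subset d)) → Unique L → Σweight L ≤ (a + b) ^ d
  Σweight≤ zero [] _ = z≤n
  Σweight≤ zero ([] ∷ []) _ = ≤-refl
  Σweight≤ zero ([] ∷ [] ∷ _) ((≢[] ∷ _) ∷ _) = ⊥-elim (≢[] refl)
  Σweight≤ (suc d) L uniq = begin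
    Σweight L                                         ≡⟨ Σweight-split L ⟩
    a * Σweight (tailsWith inside L) + b * Σweight (tailsWith outside L)
      ≤⟨ +-mono-≤ (*-monoʳ-≤ a (Σweight≤ d _ (tailsWith-unique inside L uniq)))
                  (*-monoʳ-≤ b (Σweight≤ d _ (tailsWith-unique outside L uniq))) ⟩
    a * (a + b) ^ d + b * (a + b) ^ d                 ≡⟨ sym (*-distribʳ-+ _ a b) ⟩
    (a + b) ^ suc d                                   ∎
    where open ≤-Reasoning

forest-weight : ∀ {n m} (G : Graph n m) {A} → n + n ≤ m → IsForest G A →
  n ^ n * (m ∸ n) ^ (m ∸ n) ≤ weight n (m ∸ n) A
forest-weight {n} {m} G {A} n+n≤m forest = begin
  n ^ n * (m ∸ n) ^ (m ∸ n)
    ≤⟨ a^k*b^[d∸k]-antitone (m+n≤o⇒m≤o∸n n n+n≤m) (∣forest∣≤n G forest) (≤-trans (m≤m+n n n) n+n≤m) ⟩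
  n ^ ∣ A ∣ * (m ∸ n) ^ (m ∸ ∣ A ∣)  ≡⟨ cong (λ j → n ^ ∣ A ∣ * (m ∸ n) ^ j) (sym (∣∁p∣≡n∸∣p∣ A)) ⟩
  n ^ ∣ A ∣ * (m ∸ n) ^ ∣ ∁ A ∣      ≡⟨ sym (weight≡ n (m ∸ n) A) ⟩
  weight n (m ∸ n) A                ∎
  where open ≤-Reasoning

proposition1p4 : (n m : ℕ) (G : Graph n m) → 1 ≤ n → 4 * n ≤ 2 * m →
    (L : List (Subset m)) → Unique L → All (IsForest G) L →
    length L * (n ^ n * (m ∸ n) ^ (m ∸ n)) ≤ m ^ m
proposition1p4 n m G _ 4n≤2m L uniq forests = begin
  length L * (n ^ n * (m ∸ n) ^ (m ∸ n))
    ≤⟨ length*≤sum (weight n (m ∸ n)) L (All.map (forest-weight G n+n≤m) forests) ⟩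
  Σweight n (m ∸ n) L  ≤⟨ Σweight≤ n (m ∸ n) m L uniq ⟩
  (n + (m ∸ n)) ^ m    ≡⟨ cong (_^ m) (m+[n∸m]≡n (≤-trans (m≤m+n n n) n+n≤m)) ⟩
  m ^ m                ∎
  where
  open ≤-Reasoning
  2*[n+n]≡4*n : ∀ n → 2 * (n + n) ≡ 4 * n
  2*[n+n]≡4*n = solve-∀
  n+n≤m : n + n ≤ m
  n+n≤m = *-cancelˡ-≤ 2 (≤-trans (≤-reflexive (2*[n+n]≡4*n n)) 4n≤2m)
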